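{- Let $n$ be a positive integer. The restriction of $\omega$ to $\mathcal H(n)$ attains its global minimum at the binary expansion $\vec n''$ and its global maximum at the expansion $\vec n'$ with no digit $0$.
   Context: A hyperbinary expansion of a positive integer $n$ is a word $x_1\cdots x_k$ over $\{0,1,2\}$ with $x_1\neq 0$ and $n=\sum_{i=1}^k x_i2^{k-i}$; $\mathcal H(n)$ is the set of these. $\vec n'$ is the unique element of $\mathcal H(n)$ with no digit $0$, and $\vec n''$ is the binary expansion of $n$ (the unique element with digits in $\{0,1\}$). $\omega(x_1\cdots x_k)=x_1+\cdots+x_k$. -}

module Defs where

open import Data.Nat using (ℕ; zero; suc; _+_; _*_; _≤_)
open import Data.Fin using (Fin; toℕ)
open import Data.List using (List; []; _∷_; foldl; map)
open import Data.Nat.ListAction using (sum)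
open import Data.Empty using (⊥)
open import Data.List.Relation.Unary.All using (All)
open import Data.Product using (_×_)
open import Relation.Binary.PropositionalEquality using (_≡_; _≢_)

-- A digit is an element of {0,1,2}; a word is a list of digits, most significant first.
Digit : Set
Digit = Fin 3

Word : Set
Word = List Digit

val : Word → ℕ
val = foldl (λ acc d → 2 * acc + toℕ d) 0

ω : Word → ℕ
ω w = sum (map toℕ w)

LeadingNonZero : Word → Set
LeadingNonZero [] = ⊥
LeadingNonZero (d ∷ _) = toℕ d ≢ 0

IsHyperbinary : ℕ → Word → Set
IsHyperbinary n w = LeadingNonZero w × val w ≡ n

NoZeroDigit : Word → Set
NoZeroDigit w = All (λ d → toℕ d ≢ 0) w

BinaryDigits : Word → Set
BinaryDigits w = All (λ d → toℕ d ≤ 1) w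

-- Reading a word of 𝓗(n) from the left, each digit d takes the value a read so far
-- to 2a + d. The weight s(a) of the binary expansion and the weight f(a) of the
-- zero-free expansion satisfy s(2a + d) ≤ s(a) + d and f(a) + d ≤ f(2a + d) for every
-- d ∈ {0,1,2}, so summing along any w ∈ 𝓗(n) gives s(n) ≤ ω(w) ≤ f(n). Both expansions
-- are computed on the bijective base-2 numerals ℕᵇ, whose two digits are those of the
-- zero-free expansion.

module Submission where

open import Defs
open import Data.Nat using (ℕ; _≤_; NonZero; suc; _+_; _*_; z≤n; s≤s)
open import Data.Nat.Properties
  using (≤-refl; ≤-reflexive; ≤-trans; m≤n⇒m≤1+n; n≤1+n; +-comm; +-assoc; +-identityʳ; *-suc;
         +-monoˡ-≤; +-monoʳ-≤; module ≤-Reasoning)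
open import Data.Nat.Binary.Base using (ℕᵇ; zero; 2[1+_]; 1+[2_]; double; fromℕ')
import Data.Nat.Binary.Base as Bin
open import Data.Nat.Binary.Properties using (toℕ-double; toℕ-fromℕ'; toℕ-injective; 2[1+_]-double-suc; suc≢0)
import Data.Fin as Fin
open import Data.Fin using (toℕ)
open import Data.List using ([]; _∷_; _∷ʳ_; foldl)
open import Data.List.Properties using (foldl-∷ʳ)
open import Data.List.Relation.Unary.All using ([]; _∷_)
open import Data.List.Relation.Unary.All.Properties using (∷ʳ⁺)
open import Data.Product using (Σ; _×_; _,_)
open import Relation.Binary.PropositionalEquality using (_≡_; _≢_; refl; sym; trans; cong; subst; module ≡-Reasoning)
open import Relation.Nullary using (contradiction)
open import Function using (_∘_)

pattern d0 = Fin.zero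
pattern d1 = Fin.suc Fin.zero
pattern d2 = Fin.suc (Fin.suc Fin.zero)

ω-∷ʳ : ∀ xs d → ω (xs ∷ʳ d) ≡ toℕ d + ω xs
ω-∷ʳ [] d = refl
ω-∷ʳ (x ∷ xs) d = begin
  toℕ x + ω (xs ∷ʳ d)     ≡⟨ cong (toℕ x +_) (ω-∷ʳ xs d) ⟩
  toℕ x + (toℕ d + ω xs)  ≡⟨ sym (+-assoc (toℕ x) (toℕ d) (ω xs)) ⟩
  toℕ x + toℕ d + ω xs    ≡⟨ cong (_+ ω xs) (+-comm (toℕ x) (toℕ d)) ⟩
  toℕ d + toℕ x + ω xs    ≡⟨ +-assoc (toℕ d) (toℕ x) (ω xs) ⟩
  toℕ d + (toℕ x + ω xs)  ∎
  where open ≡-Reasoning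

leadingNonZero-∷ʳ : ∀ {xs} d → LeadingNonZero xs → LeadingNonZero (xs ∷ʳ d)
leadingNonZero-∷ʳ {x ∷ xs} d x≢0 = x≢0

noZeroDigit-∷ʳ⇒leadingNonZero : ∀ {xs d} → NoZeroDigit xs → toℕ d ≢ 0 → LeadingNonZero (xs ∷ʳ d)
noZeroDigit-∷ʳ⇒leadingNonZero []          d≢0 = d≢0
noZeroDigit-∷ʳ⇒leadingNonZero (x≢0 ∷ _)  _   = x≢0

module _ {A : Set} (step : A → Digit → A) (W : A → ℕ) where

  foldl-weight-≤ : (∀ a d → W (step a d) ≤ toℕ d + W a) → ∀ a w → W (foldl step a w) ≤ W a + ω w
  foldl-weight-≤ weight-step a [] = ≤-reflexive (sym (+-identityʳ (W a)))
  foldl-weight-≤ weight-step a (d ∷ w) = begin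
    W (foldl step (step a d) w)  ≤⟨ foldl-weight-≤ weight-step (step a d) w ⟩
    W (step a d) + ω w           ≤⟨ +-monoˡ-≤ (ω w) (weight-step a d) ⟩
    toℕ d + W a + ω w            ≡⟨ cong (_+ ω w) (+-comm (toℕ d) (W a)) ⟩
    W a + toℕ d + ω w            ≡⟨ +-assoc (W a) (toℕ d) (ω w) ⟩
    W a + (toℕ d + ω w)          ∎
    where open ≤-Reasoning

  foldl-weight-≥ : (∀ a d → toℕ d + W a ≤ W (step a d)) → ∀ a w → W a + ω w ≤ W (foldl step a w)
  foldl-weight-≥ weight-step a [] = ≤-reflexive (+-identityʳ (W a))
  foldl-weight-≥ weight-step a (d ∷ w) = begin
    W a + (toℕ d + ω w)          ≡⟨ sym (+-assoc (W a) (toℕ d) (ω w)) ⟩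
    W a + toℕ d + ω w            ≡⟨ cong (_+ ω w) (+-comm (W a) (toℕ d)) ⟩
    toℕ d + W a + ω w            ≤⟨ +-monoˡ-≤ (ω w) (weight-step a d) ⟩
    W (step a d) + ω w           ≤⟨ foldl-weight-≥ weight-step (step a d) w ⟩
    W (foldl step (step a d) w)  ∎
    where open ≤-Reasoning

-- 2[1+ x ] and 1+[2 x ] are x followed by the digit 2, resp. 1.

pushDigit : ℕᵇ → Digit → ℕᵇ
pushDigit x d0 = double x
pushDigit x d1 = 1+[2 x ]
pushDigit x d2 = 2[1+ x ]

toℕ-pushDigit : ∀ x d → Bin.toℕ (pushDigit x d) ≡ 2 * Bin.toℕ x + toℕ d
toℕ-pushDigit x d0 = trans (toℕ-double x) (sym (+-identityʳ _))
toℕ-pushDigit x d1 = +-comm 1 (2 * Bin.toℕ x)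
toℕ-pushDigit x d2 = trans (*-suc 2 (Bin.toℕ x)) (+-comm 2 (2 * Bin.toℕ x))

valᵇ : Word → ℕᵇ
valᵇ = foldl pushDigit zero

toℕ-foldl-pushDigit : ∀ x w → Bin.toℕ (foldl pushDigit x w) ≡ foldl (λ acc d → 2 * acc + toℕ d) (Bin.toℕ x) w
toℕ-foldl-pushDigit x [] = refl
toℕ-foldl-pushDigit x (d ∷ w) =
  trans (toℕ-foldl-pushDigit (pushDigit x d) w)
        (cong (λ acc → foldl (λ acc d → 2 * acc + toℕ d) acc w) (toℕ-pushDigit x d))

toℕ-valᵇ : ∀ w → Bin.toℕ (valᵇ w) ≡ val w
toℕ-valᵇ = toℕ-foldl-pushDigit zero

valᵇ-unique : ∀ {x} w → val w ≡ Bin.toℕ x → valᵇ w ≡ x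
valᵇ-unique w v = toℕ-injective (trans (toℕ-valᵇ w) v)

val-valᵇ : ∀ {x} w → valᵇ w ≡ x → val w ≡ Bin.toℕ x
val-valᵇ w refl = sym (toℕ-valᵇ w)

valᵇ-∷ʳ : ∀ w d → valᵇ (w ∷ʳ d) ≡ pushDigit (valᵇ w) d
valᵇ-∷ʳ w d = foldl-∷ʳ pushDigit zero d w

-- binary x and binary⁺ x are the binary expansions of x and of x + 1.

binary binary⁺ : ℕᵇ → Word
binary zero       = []
binary 2[1+ x ]   = binary⁺ x ∷ʳ d0
binary 1+[2 x ]   = binary x ∷ʳ d1
binary⁺ zero      = d1 ∷ []
binary⁺ 2[1+ x ]  = binary⁺ x ∷ʳ d1
binary⁺ 1+[2 x ]  = binary⁺ x ∷ʳ d0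

zeroless : ℕᵇ → Word
zeroless zero      = []
zeroless 2[1+ x ]  = zeroless x ∷ʳ d2
zeroless 1+[2 x ]  = zeroless x ∷ʳ d1

valᵇ-binary : ∀ x → valᵇ (binary x) ≡ x
valᵇ-binary⁺ : ∀ x → valᵇ (binary⁺ x) ≡ Bin.suc x
valᵇ-binary zero = refl
valᵇ-binary 2[1+ x ] = begin
  valᵇ (binary⁺ x ∷ʳ d0)     ≡⟨ valᵇ-∷ʳ (binary⁺ x) d0 ⟩
  double (valᵇ (binary⁺ x))  ≡⟨ cong double (valᵇ-binary⁺ x) ⟩
  double (Bin.suc x)         ≡⟨ sym (2[1+_]-double-suc x) ⟩
  2[1+ x ]                   ∎
  where open ≡-Reasoning
valᵇ-binary 1+[2 x ] = trans (valᵇ-∷ʳ (binary x) d1) (cong 1+[2_] (valᵇ-binary x))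
valᵇ-binary⁺ zero = refl
valᵇ-binary⁺ 2[1+ x ] = trans (valᵇ-∷ʳ (binary⁺ x) d1) (cong 1+[2_] (valᵇ-binary⁺ x))
valᵇ-binary⁺ 1+[2 x ] = valᵇ-binary 2[1+ x ]

valᵇ-zeroless : ∀ x → valᵇ (zeroless x) ≡ x
valᵇ-zeroless zero = refl
valᵇ-zeroless 2[1+ x ] = trans (valᵇ-∷ʳ (zeroless x) d2) (cong 2[1+_] (valᵇ-zeroless x))
valᵇ-zeroless 1+[2 x ] = trans (valᵇ-∷ʳ (zeroless x) d1) (cong 1+[2_] (valᵇ-zeroless x))

binary-binaryDigits : ∀ x → BinaryDigits (binary x)
binary⁺-binaryDigits : ∀ x → BinaryDigits (binary⁺ x)
binary-binaryDigits zero = []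
binary-binaryDigits 2[1+ x ] = ∷ʳ⁺ (binary⁺-binaryDigits x) z≤n
binary-binaryDigits 1+[2 x ] = ∷ʳ⁺ (binary-binaryDigits x) ≤-refl
binary⁺-binaryDigits zero = ≤-refl ∷ []
binary⁺-binaryDigits 2[1+ x ] = ∷ʳ⁺ (binary⁺-binaryDigits x) ≤-refl
binary⁺-binaryDigits 1+[2 x ] = ∷ʳ⁺ (binary⁺-binaryDigits x) z≤n

zeroless-noZeroDigit : ∀ x → NoZeroDigit (zeroless x)
zeroless-noZeroDigit zero = []
zeroless-noZeroDigit 2[1+ x ] = ∷ʳ⁺ (zeroless-noZeroDigit x) (λ ())
zeroless-noZeroDigit 1+[2 x ] = ∷ʳ⁺ (zeroless-noZeroDigit x) (λ ())

binary⁺-leadingNonZero : ∀ x → LeadingNonZero (binary⁺ x)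
binary⁺-leadingNonZero zero = λ ()
binary⁺-leadingNonZero 2[1+ x ] = leadingNonZero-∷ʳ d1 (binary⁺-leadingNonZero x)
binary⁺-leadingNonZero 1+[2 x ] = leadingNonZero-∷ʳ d0 (binary⁺-leadingNonZero x)

binary-leadingNonZero : ∀ x → x ≢ zero → LeadingNonZero (binary x)
binary-leadingNonZero zero x≢0 = contradiction refl x≢0
binary-leadingNonZero 2[1+ x ] _ = leadingNonZero-∷ʳ d0 (binary⁺-leadingNonZero x)
binary-leadingNonZero 1+[2 zero ] _ = λ ()
binary-leadingNonZero 1+[2 x@(2[1+ _ ]) ] _ = leadingNonZero-∷ʳ d1 (binary-leadingNonZero x λ ())
binary-leadingNonZero 1+[2 x@(1+[2 _ ]) ] _ = leadingNonZero-∷ʳ d1 (binary-leadingNonZero x λ ())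

zeroless-leadingNonZero : ∀ x → x ≢ zero → LeadingNonZero (zeroless x)
zeroless-leadingNonZero zero x≢0 = contradiction refl x≢0
zeroless-leadingNonZero 2[1+ x ] _ = noZeroDigit-∷ʳ⇒leadingNonZero (zeroless-noZeroDigit x) λ ()
zeroless-leadingNonZero 1+[2 x ] _ = noZeroDigit-∷ʳ⇒leadingNonZero (zeroless-noZeroDigit x) λ ()

ω-binary⁺ : ∀ x → ω (binary⁺ x) ≤ 1 + ω (binary x)
ω-binary⁺ zero = ≤-refl
ω-binary⁺ 2[1+ x ] rewrite ω-∷ʳ (binary⁺ x) d1 | ω-∷ʳ (binary⁺ x) d0 = ≤-refl
ω-binary⁺ 1+[2 x ] rewrite ω-∷ʳ (binary⁺ x) d0 | ω-∷ʳ (binary x) d1 = m≤n⇒m≤1+n (ω-binary⁺ x)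

ω-binary-double : ∀ x → ω (binary (double x)) ≤ ω (binary x)
ω-binary-double zero = ≤-refl
ω-binary-double 2[1+ x ] = ≤-reflexive (ω-∷ʳ (binary⁺ x ∷ʳ d0) d0)
ω-binary-double 1+[2 x ] rewrite ω-∷ʳ (binary⁺ (double x)) d0 | ω-∷ʳ (binary x) d1 =
  ≤-trans (ω-binary⁺ (double x)) (s≤s (ω-binary-double x))

ω-binary-pushDigit : ∀ x d → ω (binary (pushDigit x d)) ≤ toℕ d + ω (binary x)
ω-binary-pushDigit x d0 = ω-binary-double x
ω-binary-pushDigit x d1 = ≤-reflexive (ω-∷ʳ (binary x) d1)
ω-binary-pushDigit x d2 rewrite ω-∷ʳ (binary⁺ x) d0 = m≤n⇒m≤1+n (ω-binary⁺ x)

ω-zeroless-double : ∀ x → ω (zeroless x) ≤ ω (zeroless (double x))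
ω-zeroless-double zero = ≤-refl
ω-zeroless-double 2[1+ x ] rewrite ω-∷ʳ (zeroless x ∷ʳ d1) d2 | ω-∷ʳ (zeroless x) d1 | ω-∷ʳ (zeroless x) d2 =
  +-monoʳ-≤ 2 (n≤1+n _)
ω-zeroless-double 1+[2 x ] rewrite ω-∷ʳ (zeroless (double x)) d2 | ω-∷ʳ (zeroless x) d1 =
  m≤n⇒m≤1+n (+-monoʳ-≤ 1 (ω-zeroless-double x))

ω-zeroless-pushDigit : ∀ x d → toℕ d + ω (zeroless x) ≤ ω (zeroless (pushDigit x d))
ω-zeroless-pushDigit x d0 = ω-zeroless-double x
ω-zeroless-pushDigit x d1 = ≤-reflexive (sym (ω-∷ʳ (zeroless x) d1))
ω-zeroless-pushDigit x d2 = ≤-reflexive (sym (ω-∷ʳ (zeroless x) d2))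

binary-minimal : ∀ x w → val w ≡ Bin.toℕ x → ω (binary x) ≤ ω w
binary-minimal x w v =
  subst (λ y → ω (binary y) ≤ ω w) (valᵇ-unique {x} w v)
        (foldl-weight-≤ pushDigit (ω ∘ binary) ω-binary-pushDigit zero w)

zeroless-maximal : ∀ x w → val w ≡ Bin.toℕ x → ω w ≤ ω (zeroless x)
zeroless-maximal x w v =
  subst (λ y → ω w ≤ ω (zeroless y)) (valᵇ-unique {x} w v)
        (foldl-weight-≥ pushDigit (ω ∘ zeroless) ω-zeroless-pushDigit zero w)

proposition3p2 : (n : ℕ) → .{{_ : NonZero n}} →
    (Σ Word (λ b → (IsHyperbinary n b × BinaryDigits b) × ((w : Word) → IsHyperbinary n w → ω b ≤ ω w)))
    × (Σ Word (λ z → (IsHyperbinary n z × NoZeroDigit z) × ((w : Word) → IsHyperbinary n w → ω w ≤ ω z)))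
proposition3p2 n@(suc m) =
    ( binary x
    , (expansion (binary-leadingNonZero x suc≢0) (valᵇ-binary x) , binary-binaryDigits x)
    , λ w (_ , v) → binary-minimal x w (trans v (sym toℕ-x)) )
  , ( zeroless x
    , (expansion (zeroless-leadingNonZero x suc≢0) (valᵇ-zeroless x) , zeroless-noZeroDigit x)
    , λ w (_ , v) → zeroless-maximal x w (trans v (sym toℕ-x)) )
  where
  x : ℕᵇ
  x = fromℕ' n

  toℕ-x : Bin.toℕ x ≡ n
  toℕ-x = toℕ-fromℕ' n

  expansion : ∀ {w} → LeadingNonZero w → valᵇ w ≡ x → IsHyperbinary n w
  expansion {w} leading w≡x = leading , trans (val-valᵇ w w≡x) toℕ-x
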